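{- Let $\leftthreetimes,\rightthreetimes\in\{\cap,\subset\}$. Define, for disjoint finite sets $X,Y$, $G\in\mathcal{H}[X]$, $G'\in\mathcal{H}[Y]$, $m_{X,Y}(G\otimes G')=GG'\in\mathbf{H}[X\sqcup Y]$, and for disjoint finite sets $I,J$ and $G\in\mathcal{H}[I\sqcup J]$, $\Delta^{(\leftthreetimes,\rightthreetimes)}_{I,J}(G)=G_{\mid_\leftthreetimes I}\otimes G_{\mid_\rightthreetimes J}\in\mathbf{H}[I]\otimes\mathbf{H}[J]$ (extended linearly). Then $(\mathbf{H},m,\Delta^{(\leftthreetimes,\rightthreetimes)})$ is a twisted bialgebra: $m$ is associative with unit the empty hypergraph; $\Delta^{(\leftthreetimes,\rightthreetimes)}$ is coassociative, i.e. $(\Delta_{I,J}\otimes\mathrm{Id})\circ\Delta_{I\sqcup J,K}=(\mathrm{Id}\otimes\Delta_{J,K})\circ\Delta_{I,J\sqcup K}$ for all pairwise disjoint $I,J,K$, with counit $\varepsilon$ given by $\varepsilon(\emptyset)=1$ (and $\varepsilon=0$ on $\mathbf{H}[X]$ for $X\neq\emptyset$); and $\Delta^{(\leftthreetimes,\rightthreetimes)}$ is compatible with $m$, i.e. for $I\sqcup J=I'\sqcup J'$, $G\in\mathcal{H}[I']$, $G'\in\mathcal{H}[J']$, $\Delta_{I,J}(GG')=(GG')_{\mid_\leftthreetimes I}\otimes(GG')_{\mid_\rightthreetimes J}$ equals $G_{\mid_\leftthreetimes I\cap I'}G'_{\mid_\leftthreetimes I\cap J'}\otimes G_{\mid_\rightthreetimes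 J\cap I'}G'_{\mid_\rightthreetimes J\cap J'}$. Moreover, the coopposite of $\Delta^{(\leftthreetimes,\rightthreetimes)}$ is $\Delta^{(\rightthreetimes,\leftthreetimes)}$; consequently $\Delta^{(\subset,\subset)}$ and $\Delta^{(\cap,\cap)}$ are cocommutative.
   Context: A hypergraph is a pair $G=(V(G),E(G))$ where $V(G)$ is a finite set and $E(G)\subseteq\mathcal{P}(V(G))$ contains $\emptyset$ and $\{x\}$ for every $x\in V(G)$. For a finite set $X$, $\mathcal{H}[X]$ is the set of hypergraphs with vertex set $X$ and $\mathbf{H}[X]$ the vector space (over a field $\mathbb{K}$ of characteristic zero) with basis $\mathcal{H}[X]$; $\mathbf{H}$ is a species, and a twisted bialgebra is a bialgebra in the category of species with the Cauchy tensor product. For $I\subseteq V(G)$: $G_{\mid_\subset I}$ has vertex set $I$ and edges $\{e\in E(G)\mid e\subseteq I\}$; $G_{\mid_\cap I}$ has vertex set $I$ and edges $\{e\cap I\mid e\in E(G)\}$. For hypergraphs $G,G'$ with disjoint vertex sets, $GG'$ has vertex set $V(G)\sqcup V(G')$ and edge set $E(G)\cup E(G')$. -}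

module Defs where

open import Data.Nat using (ℕ; _*_)
open import Data.Bool using (Bool; if_then_else_)
open import Data.Bool.Properties using () renaming (_≟_ to _≟B_)
open import Data.Vec.Properties using (≡-dec)
open import Data.Fin using (Fin)
open import Data.Fin.Subset
open import Data.Fin.Subset.Properties
open import Data.Product using (Σ; ∃; _×_; _,_; proj₁; proj₂; swap)
open import Data.Sum using (_⊎_; inj₁; inj₂)
open import Function.Bundles using (_⇔_)
open import Relation.Nullary using (yes; no; contradiction)
open import Relation.Binary.PropositionalEquality

-- Vertices are drawn from an ambient finite set Fin n;
-- a finite vertex set X is a subset X : Subset n.  The hypergraphs with V G ≡ X form the
-- set 𝓗[X] (the basis of 𝐇[X]).

record Hypergraph (n : ℕ) : Set₁ where
  field
    V       : Subset n
    E       : Subset n → Set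
    E⊆V     : ∀ e → E e → e ⊆ V
    ∅∈E     : E ⊥
    single  : ∀ x → x ∈ V → E ⁅ x ⁆
open Hypergraph public

_≈_ : ∀ {n} → Hypergraph n → Hypergraph n → Set
G ≈ H = (V G ≡ V H) × (∀ e → E G e ⇔ E H e)

-- Equality of pure tensors G ⊗ G' of basis elements in 𝐇[I] ⊗ 𝐇[J]
-- (pure tensors of basis elements are themselves basis elements).
_≈⊗_ : ∀ {n} → Hypergraph n × Hypergraph n → Hypergraph n × Hypergraph n → Set
(G , G') ≈⊗ (H , H') = (G ≈ H) × (G' ≈ H')

Disjoint : ∀ {n} → Subset n → Subset n → Set
Disjoint p q = p ∩ q ≡ ⊥

_·_ : ∀ {n} → Hypergraph n → Hypergraph n → Hypergraph n
G · G' = record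
  { V = V G ∪ V G'
  ; E = λ e → E G e ⊎ E G' e
  ; E⊆V = λ { e (inj₁ p) x∈e → p⊆p∪q (V G') (E⊆V G e p x∈e)
            ; e (inj₂ p) x∈e → q⊆p∪q (V G) (V G') (E⊆V G' e p x∈e) }
  ; ∅∈E = inj₁ (∅∈E G)
  ; single = λ x x∈ → sgl x x∈
  }
  where
  sgl : ∀ x → x ∈ V G ∪ V G' → E G ⁅ x ⁆ ⊎ E G' ⁅ x ⁆
  sgl x x∈ with x∈p∪q⁻ (V G) (V G') x∈
  ... | inj₁ p = inj₁ (single G x p)
  ... | inj₂ p = inj₂ (single G' x p)

𝟙 : ∀ {n} → Hypergraph n
𝟙 = record
  { V = ⊥
  ; E = λ e → e ≡ ⊥
  ; E⊆V = λ { e refl x∈e → x∈e }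
  ; ∅∈E = refl
  ; single = λ x x∈⊥ → contradiction x∈⊥ ∉⊥
  }

-- Restrictions.  For I ⊆ V G (the only case used below) the vertex set
-- V G ∩ I is I.

data Restr : Set where
  cap sub : Restr

private
  ⁅x⁆∩I : ∀ {n} (x : Fin n) (I : Subset n) → x ∈ I → ⁅ x ⁆ ∩ I ≡ ⁅ x ⁆
  ⁅x⁆∩I x I x∈I = ⊆-antisym (p∩q⊆p ⁅ x ⁆ I)
    (λ {y} y∈ → x∈p∩q⁺ (y∈ , subst (_∈ I) (sym (x∈⁅y⁆⇒x≡y x y∈)) x∈I))

  ⊥∩I : ∀ {n} (I : Subset n) → ⊥ ∩ I ≡ ⊥
  ⊥∩I I = ⊆-antisym (p∩q⊆p ⊥ I) ⊥⊆

  ⁅x⁆⊆ : ∀ {n} (x : Fin n) (I : Subset n) → x ∈ I → ⁅ x ⁆ ⊆ I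
  ⁅x⁆⊆ x I x∈I y∈ = subst (_∈ I) (sym (x∈⁅y⁆⇒x≡y x y∈)) x∈I

restrict⊂ : ∀ {n} → Subset n → Hypergraph n → Hypergraph n
restrict⊂ I G = record
  { V = V G ∩ I
  ; E = λ e → E G e × e ⊆ I
  ; E⊆V = λ e p x∈e → x∈p∩q⁺ (E⊆V G e (proj₁ p) x∈e , proj₂ p x∈e)
  ; ∅∈E = ∅∈E G , ⊥⊆
  ; single = λ x x∈ → let (a , b) = x∈p∩q⁻ (V G) I x∈ in
                       single G x a , ⁅x⁆⊆ x I b
  }

restrict∩ : ∀ {n} → Subset n → Hypergraph n → Hypergraph n
restrict∩ I G = record
  { V = V G ∩ I
  ; E = λ e → Σ (Subset _) λ f → E G f × f ∩ I ≡ e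
  ; E⊆V = λ { e (f , Ef , refl) x∈e →
               let (a , b) = x∈p∩q⁻ f I x∈e in x∈p∩q⁺ (E⊆V G f Ef a , b) }
  ; ∅∈E = ⊥ , ∅∈E G , ⊥∩I I
  ; single = λ x x∈ → let (a , b) = x∈p∩q⁻ (V G) I x∈ in
                       ⁅ x ⁆ , single G x a , ⁅x⁆∩I x I b
  }

restrict : ∀ {n} → Restr → Subset n → Hypergraph n → Hypergraph n
restrict cap = restrict∩
restrict sub = restrict⊂

Δ : ∀ {n} → Restr → Restr → Subset n → Subset n → Hypergraph n →
    Hypergraph n × Hypergraph n
Δ L R I J G = restrict L I G , restrict R J G

Δcop : ∀ {n} → Restr → Restr → Subset n → Subset n → Hypergraph n →
       Hypergraph n × Hypergraph n
Δcop L R I J G = swap (Δ L R J I G)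

-- Counit on basis elements: ε(G) = 1 if V G = ∅, else 0
-- (a scalar of 𝕂; only 0 and 1 occur, represented in ℕ).
ε : ∀ {n} → Hypergraph n → ℕ
ε G with ≡-dec _≟B_ (V G) ⊥
... | yes _ = 1
... | no _  = 0

-- (𝐇, m, Δ^{(L,R)}) is a twisted bialgebra, written out on basis
-- elements (all maps are the linear extensions of these).

record IsTwistedBialgebra (n : ℕ) (L R : Restr) : Set₁ where
  field
    m-assoc : ∀ (X Y Z : Subset n) (G G' G'' : Hypergraph n) →
      Disjoint X Y → Disjoint X Z → Disjoint Y Z →
      V G ≡ X → V G' ≡ Y → V G'' ≡ Z →
      ((G · G') · G'') ≈ (G · (G' · G''))
    m-unitˡ : ∀ (G : Hypergraph n) → (𝟙 · G) ≈ G
    m-unitʳ : ∀ (G : Hypergraph n) → (G · 𝟙) ≈ G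
    Δ-coassoc : ∀ (I J K : Subset n) (G : Hypergraph n) →
      Disjoint I J → Disjoint I K → Disjoint J K →
      V G ≡ (I ∪ J) ∪ K →
      let GIJ = proj₁ (Δ L R (I ∪ J) K G)
          GK  = proj₂ (Δ L R (I ∪ J) K G)
          GI  = proj₁ (Δ L R I (J ∪ K) G)
          GJK = proj₂ (Δ L R I (J ∪ K) G)
      in (proj₁ (Δ L R I J GIJ) ≈ GI)
         × (proj₂ (Δ L R I J GIJ) ≈ proj₁ (Δ L R J K GJK))
         × (GK ≈ proj₂ (Δ L R J K GJK))
    counitˡ : ∀ (X : Subset n) (G : Hypergraph n) → V G ≡ X →
      (ε (proj₁ (Δ L R ⊥ X G)) ≡ 1) × (proj₂ (Δ L R ⊥ X G) ≈ G)
    counitʳ : ∀ (X : Subset n) (G : Hypergraph n) → V G ≡ X →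
      (proj₁ (Δ L R X ⊥ G) ≈ G) × (ε (proj₂ (Δ L R X ⊥ G)) ≡ 1)
    ε-mult : ∀ (X Y : Subset n) (G G' : Hypergraph n) → Disjoint X Y →
      V G ≡ X → V G' ≡ Y → ε (G · G') ≡ ε G * ε G'
    ε-unit : ε {n} 𝟙 ≡ 1
    Δ-unit : Δ L R ⊥ ⊥ (𝟙 {n}) ≈⊗ (𝟙 , 𝟙)
    Δ-m : ∀ (I J I' J' : Subset n) (G G' : Hypergraph n) →
      Disjoint I J → Disjoint I' J' → I ∪ J ≡ I' ∪ J' →
      V G ≡ I' → V G' ≡ J' →
      Δ L R I J (G · G') ≈⊗
        ( (restrict L (I ∩ I') G · restrict L (I ∩ J') G')
        , (restrict R (J ∩ I') G · restrict R (J ∩ J') G') )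
    Δ-cop : ∀ (I J : Subset n) (G : Hypergraph n) → Disjoint I J →
      V G ≡ I ∪ J → Δcop L R I J G ≈⊗ Δ R L I J G

Cocommutative : (n : ℕ) (L R : Restr) → Set₁
Cocommutative n L R = ∀ (I J : Subset n) (G : Hypergraph n) →
  Disjoint I J → V G ≡ I ∪ J → Δcop L R I J G ≈⊗ Δ L R I J G

module Submission where

-- Coassociativity rests on two composition laws for restrictions: one kind
-- of restriction along nested sets I ⊆ P collapses to a single restriction, and the two
-- kinds of restriction commute when restricting G|P and G|Q further to P ∩ Q, provided
-- V G ⊆ P ∪ Q.  Compatibility with the product holds because an edge of GG' lies in
-- V G or in V G', so restricting GG' to I restricts G to I ∩ V G and G' to I ∩ V G'.
-- Finally Δ^cop_{I,J}(G) = G|_R I ⊗ G|_L J is Δ^{(R,L)}_{I,J}(G) on the nose.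

open import Defs
open import Data.Nat using (ℕ; _*_)
open import Data.Bool.Properties using () renaming (_≟_ to _≟B_)
open import Data.Vec.Properties using (≡-dec)
open import Data.Fin.Subset using (Subset; _∈_; _⊆_; _∩_; _∪_; ⊥)
open import Data.Fin.Subset.Properties
open import Data.Product using (_×_; _,_)
open import Data.Sum using (inj₁; inj₂)
open import Data.Sum.Algebra using (⊎-assoc)
open import Function.Bundles using (_⇔_; mk⇔)
open import Function.Properties.Inverse using (↔⇒⇔)
import Function.Properties.Equivalence as ⇔
open import Level using (0ℓ)
open import Relation.Nullary using (¬_; yes; no; contradiction)
open import Relation.Binary.PropositionalEquality
open ≡-Reasoning

private
  variable
    n : ℕ
    p q r : Subset n
    G H : Hypergraph n

p⊆q⇒p∩q≡p : p ⊆ q → p ∩ q ≡ p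
p⊆q⇒p∩q≡p {p = p} {q} p⊆q = ⊆-antisym (p∩q⊆p p q) (λ x∈p → x∈p∩q⁺ (x∈p , p⊆q x∈p))

p⊆r⇒p∩[q∩r]≡p∩q : p ⊆ r → p ∩ (q ∩ r) ≡ p ∩ q
p⊆r⇒p∩[q∩r]≡p∩q {p = p} {r} {q} p⊆r = begin
  p ∩ (q ∩ r)  ≡⟨ cong (p ∩_) (∩-comm q r) ⟩
  p ∩ (r ∩ q)  ≡⟨ ∩-assoc p r q ⟨
  (p ∩ r) ∩ q  ≡⟨ cong (_∩ q) (p⊆q⇒p∩q≡p p⊆r) ⟩
  p ∩ q        ∎

q⊆r⇒[p∩r]∩q≡p∩q : q ⊆ r → (p ∩ r) ∩ q ≡ p ∩ q
q⊆r⇒[p∩r]∩q≡p∩q {q = q} {r} {p} q⊆r = begin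
  (p ∩ r) ∩ q  ≡⟨ ∩-assoc p r q ⟩
  p ∩ (r ∩ q)  ≡⟨ cong (p ∩_) (trans (∩-comm r q) (p⊆q⇒p∩q≡p q⊆r)) ⟩
  p ∩ q        ∎

p⊆q∪r⇒p∩q⊆r⇒p⊆r : p ⊆ q ∪ r → p ∩ q ⊆ r → p ⊆ r
p⊆q∪r⇒p∩q⊆r⇒p⊆r {p = p} {q} {r} p⊆q∪r p∩q⊆r x∈p with x∈p∪q⁻ q r (p⊆q∪r x∈p)
... | inj₁ x∈q = p∩q⊆r (x∈p∩q⁺ (x∈p , x∈q))
... | inj₂ x∈r = x∈r

p∪q≡⊥⇒p≡⊥ : p ∪ q ≡ ⊥ → p ≡ ⊥
p∪q≡⊥⇒p≡⊥ {q = q} p∪q≡⊥ = ⊆-antisym (λ x∈p → subst (_ ∈_) p∪q≡⊥ (p⊆p∪q q x∈p)) ⊥⊆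

p∪q≡⊥⇒q≡⊥ : p ∪ q ≡ ⊥ → q ≡ ⊥
p∪q≡⊥⇒q≡⊥ {p = p} {q} p∪q≡⊥ = p∪q≡⊥⇒p≡⊥ (trans (∪-comm q p) p∪q≡⊥)

Disjoint⇒[p∪q]∩[q∪r]≡q : Disjoint p r → (p ∪ q) ∩ (q ∪ r) ≡ q
Disjoint⇒[p∪q]∩[q∪r]≡q {p = p} {r} {q} p∩r≡⊥ = begin
  (p ∪ q) ∩ (q ∪ r)  ≡⟨ cong (_∩ (q ∪ r)) (∪-comm p q) ⟩
  (q ∪ p) ∩ (q ∪ r)  ≡⟨ ∪-distribˡ-∩ q p r ⟨
  q ∪ (p ∩ r)        ≡⟨ cong (q ∪_) p∩r≡⊥ ⟩
  q ∪ ⊥              ≡⟨ ∪-identityʳ q ⟩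
  q                  ∎

≈-refl : G ≈ G
≈-refl = refl , λ _ → ⇔.refl

≈-sym : G ≈ H → H ≈ G
≈-sym (V≡ , E⇔) = sym V≡ , λ e → ⇔.sym (E⇔ e)

≈⊗-refl : {T : Hypergraph n × Hypergraph n} → T ≈⊗ T
≈⊗-refl {T = G , H} = ≈-refl {G = G} , ≈-refl {G = H}

·-assoc : (G H K : Hypergraph n) → ((G · H) · K) ≈ (G · (H · K))
·-assoc G H K = ∪-assoc (V G) (V H) (V K) , λ e → ↔⇒⇔ (⊎-assoc 0ℓ (E G e) (E H e) (E K e))

·-identityˡ : (G : Hypergraph n) → (𝟙 · G) ≈ G
·-identityˡ G = ∪-identityˡ (V G) , λ e → mk⇔ (λ { (inj₁ refl) → ∅∈E G ; (inj₂ Ee) → Ee }) inj₂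

·-identityʳ : (G : Hypergraph n) → (G · 𝟙) ≈ G
·-identityʳ G = ∪-identityʳ (V G) , λ e → mk⇔ (λ { (inj₁ Ee) → Ee ; (inj₂ refl) → ∅∈E G }) inj₁

ε≡1 : V G ≡ ⊥ → ε G ≡ 1
ε≡1 {G = G} V≡⊥ with ≡-dec _≟B_ (V G) ⊥
... | yes _   = refl
... | no V≢⊥  = contradiction V≡⊥ V≢⊥

ε≡0 : ¬ V G ≡ ⊥ → ε G ≡ 0
ε≡0 {G = G} V≢⊥ with ≡-dec _≟B_ (V G) ⊥
... | yes V≡⊥ = contradiction V≡⊥ V≢⊥
... | no _    = refl

ε-· : (G H : Hypergraph n) → ε (G · H) ≡ ε G * ε H
ε-· G H with ≡-dec _≟B_ (V G) ⊥ | ≡-dec _≟B_ (V H) ⊥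
... | yes VG≡⊥ | yes VH≡⊥ = ε≡1 (trans (cong₂ _∪_ VG≡⊥ VH≡⊥) (∪-identityˡ ⊥))
... | no VG≢⊥  | _        = ε≡0 (λ V≡⊥ → VG≢⊥ (p∪q≡⊥⇒p≡⊥ V≡⊥))
... | yes _    | no VH≢⊥  = ε≡0 (λ V≡⊥ → VH≢⊥ (p∪q≡⊥⇒q≡⊥ V≡⊥))

V-restrict : ∀ L I (G : Hypergraph n) → V (restrict L I G) ≡ V G ∩ I
V-restrict cap I G = refl
V-restrict sub I G = refl

V-restrict-⊥ : ∀ L (G : Hypergraph n) → V (restrict L ⊥ G) ≡ ⊥
V-restrict-⊥ L G = trans (V-restrict L ⊥ G) (∩-zeroʳ (V G))

restrict-V : ∀ L (G : Hypergraph n) → restrict L (V G) G ≈ G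
restrict-V cap G = ∩-idem (V G) , λ e → mk⇔
  (λ { (f , Ef , refl) → subst (E G) (sym (p⊆q⇒p∩q≡p (E⊆V G f Ef))) Ef })
  (λ Ee → e , Ee , p⊆q⇒p∩q≡p (E⊆V G e Ee))
restrict-V sub G = ∩-idem (V G) , λ e → mk⇔ (λ (Ee , _) → Ee) (λ Ee → Ee , λ {x} → E⊆V G e Ee {x})

restrict-restrict : ∀ L {I P} (G : Hypergraph n) → I ⊆ P →
                    restrict L I (restrict L P G) ≈ restrict L I G
restrict-restrict cap G I⊆P = q⊆r⇒[p∩r]∩q≡p∩q I⊆P , λ e → mk⇔
  (λ { (_ , (f , Ef , refl) , refl) → f , Ef , sym (q⊆r⇒[p∩r]∩q≡p∩q I⊆P) })
  (λ { (f , Ef , refl) → _ , (f , Ef , refl) , q⊆r⇒[p∩r]∩q≡p∩q I⊆P })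
restrict-restrict sub G I⊆P = q⊆r⇒[p∩r]∩q≡p∩q I⊆P , λ e → mk⇔
  (λ ((Ee , _) , e⊆I) → Ee , e⊆I)
  (λ (Ee , e⊆I) → (Ee , λ x∈e → I⊆P (e⊆I x∈e)) , e⊆I)

restrict-comm : ∀ L R {P Q} (G : Hypergraph n) → V G ⊆ P ∪ Q →
                restrict R (P ∩ Q) (restrict L P G) ≈ restrict L (P ∩ Q) (restrict R Q G)
restrict-comm L R {P} {Q} G VG⊆P∪Q = V≡ , E⇔ L R
  where
  V≡ : V (restrict R (P ∩ Q) (restrict L P G)) ≡ V (restrict L (P ∩ Q) (restrict R Q G))
  V≡ = begin
    V (restrict R (P ∩ Q) (restrict L P G))  ≡⟨ V-restrict R (P ∩ Q) _ ⟩
    V (restrict L P G) ∩ (P ∩ Q)             ≡⟨ cong (_∩ (P ∩ Q)) (V-restrict L P G) ⟩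
    (V G ∩ P) ∩ (P ∩ Q)                      ≡⟨ q⊆r⇒[p∩r]∩q≡p∩q (p∩q⊆p P Q) ⟩
    V G ∩ (P ∩ Q)                            ≡⟨ q⊆r⇒[p∩r]∩q≡p∩q (p∩q⊆q P Q) ⟨
    (V G ∩ Q) ∩ (P ∩ Q)                      ≡⟨ cong (_∩ (P ∩ Q)) (V-restrict R Q G) ⟨
    V (restrict R Q G) ∩ (P ∩ Q)             ≡⟨ V-restrict L (P ∩ Q) _ ⟨
    V (restrict L (P ∩ Q) (restrict R Q G))  ∎

  inQ : ∀ {f} → E G f → f ∩ P ⊆ P ∩ Q → f ⊆ Q
  inQ Ef s = p⊆q∪r⇒p∩q⊆r⇒p⊆r (λ x∈f → VG⊆P∪Q (E⊆V G _ Ef x∈f)) (λ x∈ → p∩q⊆q P Q (s x∈))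

  inP : ∀ {f} → E G f → f ∩ Q ⊆ P ∩ Q → f ⊆ P
  inP Ef s = p⊆q∪r⇒p∩q⊆r⇒p⊆r (λ x∈f → subst (_ ∈_) (∪-comm P Q) (VG⊆P∪Q (E⊆V G _ Ef x∈f)))
                              (λ x∈ → p∩q⊆p P Q (s x∈))

  ∩P≡∩[P∩Q] : ∀ {f} → f ⊆ Q → f ∩ P ≡ f ∩ (P ∩ Q)
  ∩P≡∩[P∩Q] f⊆Q = sym (p⊆r⇒p∩[q∩r]≡p∩q f⊆Q)

  ∩Q≡∩[P∩Q] : ∀ {f} → f ⊆ P → f ∩ Q ≡ f ∩ (P ∩ Q)
  ∩Q≡∩[P∩Q] {f} f⊆P = trans (sym (p⊆r⇒p∩[q∩r]≡p∩q f⊆P)) (cong (f ∩_) (∩-comm Q P))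

  E⇔ : ∀ L R e → E (restrict R (P ∩ Q) (restrict L P G)) e ⇔ E (restrict L (P ∩ Q) (restrict R Q G)) e
  E⇔ cap cap e = mk⇔
    (λ { (_ , (f , Ef , refl) , refl) → f ∩ Q , (f , Ef , refl) ,
           trans (q⊆r⇒[p∩r]∩q≡p∩q (p∩q⊆q P Q)) (sym (q⊆r⇒[p∩r]∩q≡p∩q (p∩q⊆p P Q))) })
    (λ { (_ , (f , Ef , refl) , refl) → f ∩ P , (f , Ef , refl) ,
           trans (q⊆r⇒[p∩r]∩q≡p∩q (p∩q⊆p P Q)) (sym (q⊆r⇒[p∩r]∩q≡p∩q (p∩q⊆q P Q))) })
  E⇔ sub sub e = mk⇔
    (λ ((Ee , _) , e⊆P∩Q) → (Ee , λ x∈e → p∩q⊆q P Q (e⊆P∩Q x∈e)) , e⊆P∩Q)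
    (λ ((Ee , _) , e⊆P∩Q) → (Ee , λ x∈e → p∩q⊆p P Q (e⊆P∩Q x∈e)) , e⊆P∩Q)
  E⇔ cap sub e = mk⇔
    (λ { ((f , Ef , refl) , s) → f , (Ef , inQ Ef s) , sym (∩P≡∩[P∩Q] (inQ Ef s)) })
    (λ { (f , (Ef , f⊆Q) , refl) → (f , Ef , ∩P≡∩[P∩Q] f⊆Q) , p∩q⊆q f (P ∩ Q) })
  E⇔ sub cap e = mk⇔
    (λ { (f , (Ef , f⊆P) , refl) → (f , Ef , ∩Q≡∩[P∩Q] f⊆P) , p∩q⊆q f (P ∩ Q) })
    (λ { ((f , Ef , refl) , s) → f , (Ef , inP Ef s) , sym (∩Q≡∩[P∩Q] (inP Ef s)) })

restrict-· : ∀ L I (G H : Hypergraph n) →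
             restrict L I (G · H) ≈ (restrict L (I ∩ V G) G · restrict L (I ∩ V H) H)
restrict-· L I G H = V≡ , E⇔ L
  where
  V≡ : V (restrict L I (G · H)) ≡ V (restrict L (I ∩ V G) G · restrict L (I ∩ V H) H)
  V≡ = begin
    V (restrict L I (G · H))                               ≡⟨ V-restrict L I (G · H) ⟩
    (V G ∪ V H) ∩ I                                        ≡⟨ ∩-distribʳ-∪ I (V G) (V H) ⟩
    (V G ∩ I) ∪ (V H ∩ I)                                  ≡⟨ cong₂ _∪_ (p⊆r⇒p∩[q∩r]≡p∩q (λ x∈ → x∈))
                                                                       (p⊆r⇒p∩[q∩r]≡p∩q (λ x∈ → x∈)) ⟨
    (V G ∩ (I ∩ V G)) ∪ (V H ∩ (I ∩ V H))                  ≡⟨ cong₂ _∪_ (V-restrict L (I ∩ V G) G)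
                                                                       (V-restrict L (I ∩ V H) H) ⟨
    V (restrict L (I ∩ V G) G · restrict L (I ∩ V H) H)    ∎

  E⇔ : ∀ L e → E (restrict L I (G · H)) e ⇔ E (restrict L (I ∩ V G) G · restrict L (I ∩ V H) H) e
  E⇔ cap e = mk⇔
    (λ { (f , inj₁ Ef , refl) → inj₁ (f , Ef , p⊆r⇒p∩[q∩r]≡p∩q (E⊆V G f Ef))
       ; (f , inj₂ Ef , refl) → inj₂ (f , Ef , p⊆r⇒p∩[q∩r]≡p∩q (E⊆V H f Ef)) })
    (λ { (inj₁ (f , Ef , refl)) → f , inj₁ Ef , sym (p⊆r⇒p∩[q∩r]≡p∩q (E⊆V G f Ef))
       ; (inj₂ (f , Ef , refl)) → f , inj₂ Ef , sym (p⊆r⇒p∩[q∩r]≡p∩q (E⊆V H f Ef)) })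
  E⇔ sub e = mk⇔
    (λ { (inj₁ Ee , e⊆I) → inj₁ (Ee , λ x∈e → x∈p∩q⁺ (e⊆I x∈e , E⊆V G e Ee x∈e))
       ; (inj₂ Ee , e⊆I) → inj₂ (Ee , λ x∈e → x∈p∩q⁺ (e⊆I x∈e , E⊆V H e Ee x∈e)) })
    (λ { (inj₁ (Ee , e⊆I∩VG)) → inj₁ Ee , (λ x∈e → p∩q⊆p I (V G) (e⊆I∩VG x∈e))
       ; (inj₂ (Ee , e⊆I∩VH)) → inj₂ Ee , (λ x∈e → p∩q⊆p I (V H) (e⊆I∩VH x∈e)) })

Δcop≈⊗Δ : ∀ L R I J (G : Hypergraph n) → Δcop L R I J G ≈⊗ Δ R L I J G
Δcop≈⊗Δ L R I J G = ≈⊗-refl {T = Δ R L I J G}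

Δ-coassoc : ∀ L R (I J K : Subset n) (G : Hypergraph n) → Disjoint I K → V G ≡ (I ∪ J) ∪ K →
  (restrict L I (restrict L (I ∪ J) G) ≈ restrict L I G)
  × (restrict R J (restrict L (I ∪ J) G) ≈ restrict L J (restrict R (J ∪ K) G))
  × (restrict R K G ≈ restrict R K (restrict R (J ∪ K) G))
Δ-coassoc L R I J K G I∩K≡⊥ refl =
    restrict-restrict L G (p⊆p∪q J)
  , subst (λ S → restrict R S (restrict L (I ∪ J) G) ≈ restrict L S (restrict R (J ∪ K) G))
          (Disjoint⇒[p∪q]∩[q∪r]≡q I∩K≡⊥)
          (restrict-comm L R G VG⊆[I∪J]∪[J∪K])
  , ≈-sym {G = restrict R K (restrict R (J ∪ K) G)} {H = restrict R K G}
      (restrict-restrict R G (q⊆p∪q J K))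
  where
  VG⊆[I∪J]∪[J∪K] : (I ∪ J) ∪ K ⊆ (I ∪ J) ∪ (J ∪ K)
  VG⊆[I∪J]∪[J∪K] x∈ with x∈p∪q⁻ (I ∪ J) K x∈
  ... | inj₁ x∈I∪J = p⊆p∪q (J ∪ K) x∈I∪J
  ... | inj₂ x∈K   = q⊆p∪q (I ∪ J) (J ∪ K) (q⊆p∪q J K x∈K)

isTwistedBialgebra : ∀ n L R → IsTwistedBialgebra n L R
isTwistedBialgebra n L R = record
  { m-assoc   = λ _ _ _ G H K _ _ _ _ _ _ → ·-assoc G H K
  ; m-unitˡ   = ·-identityˡ
  ; m-unitʳ   = ·-identityʳ
  ; Δ-coassoc = λ I J K G _ I∩K≡⊥ _ VG≡ → Δ-coassoc L R I J K G I∩K≡⊥ VG≡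
  ; counitˡ   = λ { _ G refl → ε≡1 (V-restrict-⊥ L G) , restrict-V R G }
  ; counitʳ   = λ { _ G refl → restrict-V L G , ε≡1 (V-restrict-⊥ R G) }
  ; ε-mult    = λ _ _ G H _ _ _ → ε-· G H
  ; ε-unit    = ε≡1 {G = 𝟙} refl
  ; Δ-unit    = restrict-V L 𝟙 , restrict-V R 𝟙
  ; Δ-m       = λ { I J _ _ G H _ _ _ refl refl → restrict-· L I G H , restrict-· R J G H }
  ; Δ-cop     = λ I J G _ _ → Δcop≈⊗Δ L R I J G
  }

proposition1p2 : (∀ (n : ℕ) (L R : Restr) → IsTwistedBialgebra n L R)
    × (∀ (n : ℕ) → Cocommutative n sub sub)
    × (∀ (n : ℕ) → Cocommutative n cap cap)
proposition1p2 =
    isTwistedBialgebra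
  , (λ n I J G _ _ → Δcop≈⊗Δ sub sub I J G)
  , (λ n I J G _ _ → Δcop≈⊗Δ cap cap I J G)
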